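{- Let $p\ge 2$ be an integer and let $\frac{a}{p},\frac{b}{p}$ be irreducible fractions with $a\equiv -b\pmod p$. Then $\mathcal{S}_{\frac{a}{p}}(q)=\mathcal{S}^\vee_{\frac{b}{p}}(q)$.
   Context: For an integer $c$, $[c]_q=\frac{1-q^c}{1-q}$. Every rational $\alpha>1$ has a unique negative continued fraction expansion $\alpha=c_1-\cfrac{1}{c_2-\cfrac{1}{\ddots-\cfrac{1}{c_l}}}$ with integers $c_j\ge 2$. Put $M^-_q(c)=\begin{pmatrix}[c]_q & -q^{c-1}\\ 1 & 0\end{pmatrix}$ and define $\mathcal{R}_\alpha(q),\mathcal{S}_\alpha(q)$ by $\begin{pmatrix}\mathcal{R}_\alpha(q)\\ \mathcal{S}_\alpha(q)\end{pmatrix}=M^-_q(c_1)\cdots M^-_q(c_l)\begin{pmatrix}1\\0\end{pmatrix}$. For rational $\alpha\le 1$ these are defined recursively by $\mathcal{S}_\alpha(q)=\mathcal{S}_{\alpha+1}(q)$ and $\mathcal{R}_\alpha(q)=q^{ -1}(\mathcal{R}_{\alpha+1}(q)-\mathcal{S}_{\alpha+1}(q))$. For every rational $\alpha$, $\mathcal{S}_\alpha(q)\in\mathbb Z[q]$. For a nonzero polynomial $f(q)$, its reciprocal polynomial is $f^\vee(q)=q^{\deg f}f(q^{ -1})$. An irreducible fraction $\frac{r}{s}$ means $\gcd(r,s)=1$, $s>0$. -}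

module Defs where

open import Data.Nat as ℕ using (ℕ; zero; suc; _≤ᵇ_)
open import Data.Nat.DivMod using (_/_; _%_)
open import Data.Integer as ℤ using (ℤ; +_; -[1+_]; ∣_∣; _-_)
open import Relation.Binary.PropositionalEquality using (_≡_)
open import Relation.Nullary using (yes; no)
open import Data.Integer.Properties using () renaming (_≟_ to _≟ℤ_)
open import Data.List using (List; []; _∷_; reverse; dropWhile; replicate; _++_; map)
open import Data.Product using (_×_; _,_; proj₂)
open import Data.Bool using (if_then_else_)

-- Polynomials in ℤ[q] as coefficient lists, lowest degree first.

Poly : Set
Poly = List ℤ

infixl 6 _+ₚ_
infixl 7 _*ₚ_

_+ₚ_ : Poly → Poly → Poly
[]       +ₚ g        = g
(a ∷ f)  +ₚ []       = a ∷ f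
(a ∷ f)  +ₚ (b ∷ g)  = (a ℤ.+ b) ∷ (f +ₚ g)

negₚ : Poly → Poly
negₚ = map (λ x → ℤ.- x)

_*ₚ_ : Poly → Poly → Poly
[]      *ₚ g = []
(a ∷ f) *ₚ g = map (a ℤ.*_) g +ₚ (+ 0 ∷ (f *ₚ g))

norm : Poly → Poly
norm f = reverse (dropWhile (λ x → x ≟ℤ + 0) (reverse f))

_≈ₚ_ : Poly → Poly → Set
f ≈ₚ g = norm f ≡ norm g

-- reciprocal polynomial f^∨(q) = q^{deg f} f(q⁻¹): reverse the
-- coefficient list of f after dropping its trailing zeros
reciprocal : Poly → Poly
reciprocal f = reverse (norm f)

qint : ℕ → Poly
qint c = replicate c (+ 1)

qpow : ℕ → Poly
qpow k = replicate k (+ 0) ++ (+ 1 ∷ [])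

-- Negative continued fraction of r/s (r > s > 0), as the list c₁ … c_l.
-- If s ∣ r the expansion is [r/s]; otherwise c₁ = ⌊r/s⌋ + 1 and
-- r/s = c₁ - 1/(s/(s - r mod s)).  Denominators strictly decrease, so
-- fuel s suffices (the fuel is only a termination device).

negCF-fuel : ℕ → ℕ → ℕ → List ℕ
negCF-fuel zero    r s       = []
negCF-fuel (suc n) r zero    = []
negCF-fuel (suc n) r (suc s) with r % suc s
... | zero  = (r / suc s) ∷ []
... | suc t = suc (r / suc s) ∷ negCF-fuel n (suc s) (suc s ℕ.∸ suc t)

negCF : ℕ → ℕ → List ℕ
negCF r s = negCF-fuel s r s

-- M⁻_q(c₁) ⋯ M⁻_q(c_l) (1,0)ᵀ, with M⁻_q(c) = ([c]_q , -q^{c-1} ; 1 , 0)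
matProd : List ℕ → Poly × Poly
matProd []       = (+ 1 ∷ [] , [])
matProd (c ∷ cs) with matProd cs
... | (R , S) = (qint c *ₚ R +ₚ negₚ (qpow (c ℕ.∸ 1) *ₚ S) , R)

RS>1 : ℕ → ℕ → Poly × Poly
RS>1 r s = matProd (negCF r s)

-- S_α for α = a/p, a : ℤ, p > 0.  If α > 1 use the continued fraction.
-- If α ≤ 1, S_α = S_{α+1} = … = S_{α+n} with n the least integer such
-- that α + n > 1; with m = p - a ≥ 0 this is n = ⌊m/p⌋ + 1.
𝒮 : ℤ → ℕ → Poly
𝒮 (+ r)    zero    = []
𝒮 -[1+ r ] zero    = []
𝒮 a (suc s) with ℤ.+ suc s ℤ.<? a
... | yes _ = proj₂ (RS>1 ∣ a ∣ (suc s))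
... | no  _ = proj₂ (RS>1 ∣ a ℤ.+ (+ suc s) ℤ.* (+ suc (∣ (+ suc s) - a ∣ / suc s)) ∣ (suc s))

-- For a numerator r with r mod p = t ≠ 0, the negative continued fraction of r/p is
-- ⌈r/p⌉ followed by that of p/(p − t), so S_{r/p} = R_{p/(p−t)}.  Coprimality makes the
-- residues of a and b nonzero and a ≡ −b (mod p) makes them add up to p, so the claim
-- becomes R_{p/T} = R_{p/S}^∨ whenever S + T = p.  This is proved together with the
-- companion identities S_{p/S}^∨ = R_{p/T} − S_{p/T} (and the same with S, T exchanged),
-- all read in one common degree, by Euclid's algorithm on (S, T): the case (S, S + U)
-- follows from (S, U) because (2S + U)/S = (S + U)/S + 1 and
-- (2S + U)/(S + U) = 2 − 1/((S + U)/U), and each of these moves transforms (R, S) by a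
-- short linear recurrence.  Polynomials are handled through their coefficient functions
-- ℕ → ℤ, on which reversal in a fixed degree is linear.

module Submission where

open import Defs
open import Data.Nat using (ℕ; _≤_)
open import Data.Nat.Coprimality using (Coprime)
open import Data.Integer using (ℤ; +_; _+_; ∣_∣)
open import Data.Integer.Divisibility using (_∣_)

open import Data.Nat as ℕ using (zero; suc; _<_; _∸_; pred; z≤n; s≤s; NonZero)
import Data.Nat.Properties as ℕP
open import Data.Nat.DivMod using (_/_; _%_; m≡m%n+[m/n]*n; m%n≤n; m%n<n; %-distribˡ-+;
  %-remove-+ˡ; %-remove-+ʳ; +-distrib-/-∣ˡ; +-distrib-/-∣ʳ; n/n≡1; n%n≡0; m<n⇒m%n≡m;
  m<n⇒m/n≡0; m≥n⇒m/n>0)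
open import Data.Nat.Divisibility as ℕ∣ using (divides; ∣-refl; m%n≡0⇒n∣m; n∣m⇒m%n≡0)
open import Data.Integer as ℤ using (-[1+_]; _-_; -_; _*_)
import Data.Integer.Properties as ℤP
open import Data.Integer.Divisibility.Signed as Signed using (∣ᵤ⇒∣; ∣⇒∣ᵤ)
  renaming (_∣_ to _∣ₛ_)
open import Data.Integer.Tactic.RingSolver using (solve-∀)
open import Data.List using (List; []; _∷_; _++_; _∷ʳ_; map; reverse; length; dropWhile)
import Data.List.Properties as List
open import Data.Product using (∃; ∃₂; _×_; _,_; proj₁; proj₂)
open import Function using (_∘_)
open import Relation.Nullary using (yes; no; ¬_; contradiction)
open import Relation.Binary.PropositionalEquality
open import Relation.Binary.Definitions using (tri<; tri≈; tri>)

-- Polynomials as coefficient functions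

Series : Set
Series = ℕ → ℤ

infix 4 _≐_
_≐_ : Series → Series → Set
f ≐ g = ∀ n → f n ≡ g n

infixl 6 _⊕_ _⊖_
_⊕_ _⊖_ : Series → Series → Series
(f ⊕ g) n = f n + g n
(f ⊖ g) n = f n - g n

coeff : Poly → Series
coeff []      n       = + 0
coeff (a ∷ f) zero    = a
coeff (a ∷ f) (suc n) = coeff f n

shift : Series → Series
shift f zero    = + 0
shift f (suc n) = f n

shiftBy : ℕ → Series → Series
shiftBy zero    f = f
shiftBy (suc k) f = shift (shiftBy k f)

qintₛ : ℕ → Series → Series
qintₛ zero    f = λ _ → + 0
qintₛ (suc c) f = f ⊕ shift (qintₛ c f)

shift-cong : ∀ {f g} → f ≐ g → shift f ≐ shift g
shift-cong f≐g zero    = refl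
shift-cong f≐g (suc n) = f≐g n

coeff-+ₚ : ∀ f g → coeff (f +ₚ g) ≐ coeff f ⊕ coeff g
coeff-+ₚ []      g       n       = sym (ℤP.+-identityˡ (coeff g n))
coeff-+ₚ (a ∷ f) []      n       = sym (ℤP.+-identityʳ (coeff (a ∷ f) n))
coeff-+ₚ (a ∷ f) (b ∷ g) zero    = refl
coeff-+ₚ (a ∷ f) (b ∷ g) (suc n) = coeff-+ₚ f g n

coeff-negₚ : ∀ f n → coeff (negₚ f) n ≡ - coeff f n
coeff-negₚ []      n       = refl
coeff-negₚ (a ∷ f) zero    = refl
coeff-negₚ (a ∷ f) (suc n) = coeff-negₚ f n

coeff-map-* : ∀ a f n → coeff (map (a *_) f) n ≡ a * coeff f n
coeff-map-* a []      n       = sym (ℤP.*-zeroʳ a)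
coeff-map-* a (b ∷ f) zero    = refl
coeff-map-* a (b ∷ f) (suc n) = coeff-map-* a f n

coeff-0∷ : ∀ f → coeff (+ 0 ∷ f) ≐ shift (coeff f)
coeff-0∷ f zero    = refl
coeff-0∷ f (suc n) = refl

coeff-∷-*ₚ : ∀ a f g → coeff ((a ∷ f) *ₚ g) ≐ λ n → a * coeff g n + shift (coeff (f *ₚ g)) n
coeff-∷-*ₚ a f g n =
  trans (coeff-+ₚ (map (a *_) g) _ n) (cong₂ _+_ (coeff-map-* a g n) (coeff-0∷ (f *ₚ g) n))

coeff-qint-*ₚ : ∀ c f → coeff (qint c *ₚ f) ≐ qintₛ c (coeff f)
coeff-qint-*ₚ zero    f n = refl
coeff-qint-*ₚ (suc c) f n =
  trans (coeff-∷-*ₚ (+ 1) (qint c) f n)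
        (cong₂ _+_ (ℤP.*-identityˡ (coeff f n)) (shift-cong (coeff-qint-*ₚ c f) n))

coeff-qpow-*ₚ : ∀ k f → coeff (qpow k *ₚ f) ≐ shiftBy k (coeff f)
coeff-qpow-*ₚ zero    f zero    =
  trans (coeff-∷-*ₚ (+ 1) [] f 0) (trans (ℤP.+-identityʳ _) (ℤP.*-identityˡ _))
coeff-qpow-*ₚ zero    f (suc n) =
  trans (coeff-∷-*ₚ (+ 1) [] f (suc n)) (trans (ℤP.+-identityʳ _) (ℤP.*-identityˡ _))
coeff-qpow-*ₚ (suc k) f n =
  trans (coeff-∷-*ₚ (+ 0) (qpow k) f n)
        (trans (ℤP.+-identityˡ _) (shift-cong (coeff-qpow-*ₚ k f) n))

Rₚ Sₚ : List ℕ → Poly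
Rₚ cs = proj₁ (matProd cs)
Sₚ cs = proj₂ (matProd cs)

R[_] S[_] : List ℕ → Series
R[ cs ] = coeff (Rₚ cs)
S[ cs ] = coeff (Sₚ cs)

R-∷ : ∀ c cs → R[ c ∷ cs ] ≐ qintₛ c R[ cs ] ⊖ shiftBy (c ∸ 1) S[ cs ]
R-∷ c cs n = begin
  coeff (qint c *ₚ R +ₚ negₚ (qpow (c ∸ 1) *ₚ S)) n
    ≡⟨ coeff-+ₚ (qint c *ₚ R) _ n ⟩
  coeff (qint c *ₚ R) n + coeff (negₚ (qpow (c ∸ 1) *ₚ S)) n
    ≡⟨ cong₂ _+_ (coeff-qint-*ₚ c R n)
                 (trans (coeff-negₚ (qpow (c ∸ 1) *ₚ S) n) (cong -_ (coeff-qpow-*ₚ (c ∸ 1) S n))) ⟩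
  qintₛ c (coeff R) n - shiftBy (c ∸ 1) (coeff S) n ∎
  where
  open ≡-Reasoning
  R = Rₚ cs
  S = Sₚ cs

R-1∷ : ∀ cs → R[ 1 ∷ cs ] ≐ R[ cs ] ⊖ S[ cs ]
R-1∷ cs zero    = trans (R-∷ 1 cs 0) (cong (_- S[ cs ] 0) (ℤP.+-identityʳ (R[ cs ] 0)))
R-1∷ cs (suc n) = trans (R-∷ 1 cs (suc n)) (cong (_- S[ cs ] (suc n)) (ℤP.+-identityʳ (R[ cs ] (suc n))))

-- [c+2]_q = 1 + q [c+1]_q  and  q^{c+1} = q · q^c
R-2+∷ : ∀ c cs → R[ suc (suc c) ∷ cs ] ≐ shift R[ suc c ∷ cs ] ⊕ R[ cs ]
R-2+∷ c cs n = trans (R-∷ (suc (suc c)) cs n) (regroup n)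
  where
  move-+- : ∀ r x y → (r + x) - y ≡ (x - y) + r
  move-+- = solve-∀
  regroup : ∀ n → (qintₛ (suc (suc c)) R[ cs ] ⊖ shiftBy (suc c) S[ cs ]) n
                 ≡ (shift R[ suc c ∷ cs ] ⊕ R[ cs ]) n
  regroup zero    = move-+- (R[ cs ] 0) (+ 0) (+ 0)
  regroup (suc n) = trans (move-+- (R[ cs ] (suc n)) _ _)
                          (cong (_+ R[ cs ] (suc n)) (sym (R-∷ (suc c) cs n)))

-- Reversal in a fixed degree

-- rev d f is n ↦ f (d ∸ n) on 0 … d and 0 beyond d: the reciprocal of f read in degree d.
rev : ℕ → Series → Series
rev zero    f zero    = f zero
rev zero    f (suc n) = + 0
rev (suc d) f zero    = f (suc d)
rev (suc d) f (suc n) = rev d f n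

Degree≤ : ℕ → Series → Set
Degree≤ d f = ∀ n → d < n → f n ≡ + 0

rev-0 : ∀ d f → rev d f 0 ≡ f d
rev-0 zero    f = refl
rev-0 (suc d) f = refl

rev-cong : ∀ d {f g} → f ≐ g → rev d f ≐ rev d g
rev-cong zero    f≐g zero    = f≐g 0
rev-cong zero    f≐g (suc n) = refl
rev-cong (suc d) f≐g zero    = f≐g (suc d)
rev-cong (suc d) f≐g (suc n) = rev-cong d f≐g n

rev-⊕ : ∀ d f g → rev d (f ⊕ g) ≐ rev d f ⊕ rev d g
rev-⊕ zero    f g zero    = refl
rev-⊕ zero    f g (suc n) = refl
rev-⊕ (suc d) f g zero    = refl
rev-⊕ (suc d) f g (suc n) = rev-⊕ d f g n

rev-⊖ : ∀ d f g → rev d (f ⊖ g) ≐ rev d f ⊖ rev d g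
rev-⊖ zero    f g zero    = refl
rev-⊖ zero    f g (suc n) = refl
rev-⊖ (suc d) f g zero    = refl
rev-⊖ (suc d) f g (suc n) = rev-⊖ d f g n

rev-shift : ∀ d f → rev (suc d) (shift f) ≐ rev d f
rev-shift d       f zero          = sym (rev-0 d f)
rev-shift zero    f (suc zero)    = refl
rev-shift zero    f (suc (suc n)) = refl
rev-shift (suc d) f (suc n)       = rev-shift d f n

rev-suc : ∀ d f → Degree≤ d f → rev (suc d) f ≐ shift (rev d f)
rev-suc d f deg zero    = deg (suc d) ℕP.≤-refl
rev-suc d f deg (suc n) = refl

Degree≤-resp : ∀ {d f g} → f ≐ g → Degree≤ d g → Degree≤ d f
Degree≤-resp f≐g deg n d<n = trans (f≐g n) (deg n d<n)

Degree≤-suc : ∀ {d f} → Degree≤ d f → Degree≤ (suc d) f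
Degree≤-suc deg n d<n = deg n (ℕP.<-trans ℕP.≤-refl d<n)

Degree≤-shift : ∀ {d f} → Degree≤ d f → Degree≤ (suc d) (shift f)
Degree≤-shift deg (suc n) (s≤s d<n) = deg n d<n

Degree≤-⊕ : ∀ {d f g} → Degree≤ d f → Degree≤ d g → Degree≤ d (f ⊕ g)
Degree≤-⊕ degf degg n d<n = cong₂ _+_ (degf n d<n) (degg n d<n)

Degree≤-⊖ : ∀ {d f g} → Degree≤ d f → Degree≤ d g → Degree≤ d (f ⊖ g)
Degree≤-⊖ degf degg n d<n = cong₂ _-_ (degf n d<n) (degg n d<n)

record Mirror (A B C D : Series) : Set where
  field
    degree : ℕ
    deg-A  : Degree≤ degree A
    deg-B  : Degree≤ degree B
    deg-C  : Degree≤ degree C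
    deg-D  : Degree≤ degree D
    rev-A  : rev degree A ≐ C
    rev-C  : rev degree C ≐ A
    rev-B  : rev degree B ≐ C ⊖ D
    rev-D  : rev degree D ≐ A ⊖ B
    A-0    : A 0 ≡ + 1
    B-0    : B 0 ≡ + 1
    C-0    : C 0 ≡ + 1
    D-0    : D 0 ≡ + 1

mirror-swap : ∀ {A B C D} → Mirror A B C D → Mirror C D A B
mirror-swap m = record
  { degree = degree
  ; deg-A = deg-C ; deg-B = deg-D ; deg-C = deg-A ; deg-D = deg-B
  ; rev-A = rev-C ; rev-C = rev-A ; rev-B = rev-D ; rev-D = rev-B
  ; A-0 = C-0 ; B-0 = D-0 ; C-0 = A-0 ; D-0 = B-0
  }
  where open Mirror m

mirror-resp : ∀ {A B C D A′ B′ C′ D′} → A′ ≐ A → B′ ≐ B → C′ ≐ C → D′ ≐ D →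
              Mirror A B C D → Mirror A′ B′ C′ D′
mirror-resp {A} {B} {C} {D} eA eB eC eD m = record
  { degree = degree
  ; deg-A = Degree≤-resp eA deg-A ; deg-B = Degree≤-resp eB deg-B
  ; deg-C = Degree≤-resp eC deg-C ; deg-D = Degree≤-resp eD deg-D
  ; rev-A = λ n → trans (rev-cong degree eA n) (trans (rev-A n) (sym (eC n)))
  ; rev-C = λ n → trans (rev-cong degree eC n) (trans (rev-C n) (sym (eA n)))
  ; rev-B = λ n → trans (rev-cong degree eB n) (trans (rev-B n) (sym (cong₂ _-_ (eC n) (eD n))))
  ; rev-D = λ n → trans (rev-cong degree eD n) (trans (rev-D n) (sym (cong₂ _-_ (eA n) (eB n))))
  ; A-0 = trans (eA 0) A-0 ; B-0 = trans (eB 0) B-0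
  ; C-0 = trans (eC 0) C-0 ; D-0 = trans (eD 0) D-0
  }
  where open Mirror m

mirror-base : Mirror (coeff (+ 1 ∷ + 1 ∷ [])) (coeff (+ 1 ∷ []))
                     (coeff (+ 1 ∷ + 1 ∷ [])) (coeff (+ 1 ∷ []))
mirror-base = record
  { degree = 1
  ; deg-A = deg-11 ; deg-B = deg-1 ; deg-C = deg-11 ; deg-D = deg-1
  ; rev-A = rev-11 ; rev-C = rev-11 ; rev-B = rev-1 ; rev-D = rev-1
  ; A-0 = refl ; B-0 = refl ; C-0 = refl ; D-0 = refl
  }
  where
  deg-11 : Degree≤ 1 (coeff (+ 1 ∷ + 1 ∷ []))
  deg-11 (suc zero)    (s≤s ())
  deg-11 (suc (suc n)) _ = refl
  deg-1 : Degree≤ 1 (coeff (+ 1 ∷ []))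
  deg-1 (suc zero)    (s≤s ())
  deg-1 (suc (suc n)) _ = refl
  rev-11 : rev 1 (coeff (+ 1 ∷ + 1 ∷ [])) ≐ coeff (+ 1 ∷ + 1 ∷ [])
  rev-11 zero          = refl
  rev-11 (suc zero)    = refl
  rev-11 (suc (suc n)) = refl
  rev-1 : rev 1 (coeff (+ 1 ∷ [])) ≐ coeff (+ 1 ∷ + 1 ∷ []) ⊖ coeff (+ 1 ∷ [])
  rev-1 zero          = refl
  rev-1 (suc zero)    = refl
  rev-1 (suc (suc n)) = refl

-- (R, S) at p/S and at p/T under the Euclid step (S, U) ↦ (S, S + U), see mirrorCF-step.
mirror-step : ∀ {A B C D} → Mirror A B C D → Mirror (shift A ⊕ B) B (shift (C ⊖ D) ⊕ C) C
mirror-step {A} {B} {C} {D} m = record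
  { degree = suc degree
  ; deg-A = Degree≤-⊕ (Degree≤-shift deg-A) (Degree≤-suc deg-B)
  ; deg-B = Degree≤-suc deg-B
  ; deg-C = Degree≤-⊕ (Degree≤-shift (Degree≤-⊖ deg-C deg-D)) (Degree≤-suc deg-C)
  ; deg-D = Degree≤-suc deg-C
  ; rev-A = rev-A′ ; rev-C = rev-C′ ; rev-B = rev-B′ ; rev-D = rev-D′
  ; A-0 = trans (ℤP.+-identityˡ (B 0)) B-0
  ; B-0 = B-0
  ; C-0 = trans (ℤP.+-identityˡ (C 0)) C-0
  ; D-0 = C-0
  }
  where
  open Mirror m
  open ≡-Reasoning
  x≡x+y-y : ∀ x y → x ≡ x + y - y
  x≡x+y-y = solve-∀
  rev-A′ : rev (suc degree) (shift A ⊕ B) ≐ shift (C ⊖ D) ⊕ C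
  rev-A′ n = begin
    rev (suc degree) (shift A ⊕ B) n               ≡⟨ rev-⊕ (suc degree) (shift A) B n ⟩
    rev (suc degree) (shift A) n + rev (suc degree) B n
      ≡⟨ cong₂ _+_ (rev-shift degree A n) (rev-suc degree B deg-B n) ⟩
    rev degree A n + shift (rev degree B) n         ≡⟨ cong₂ _+_ (rev-A n) (shift-cong rev-B n) ⟩
    C n + shift (C ⊖ D) n                           ≡⟨ ℤP.+-comm (C n) _ ⟩
    shift (C ⊖ D) n + C n                           ∎
  rev-C′ : rev (suc degree) (shift (C ⊖ D) ⊕ C) ≐ shift A ⊕ B
  rev-C′ n = begin
    rev (suc degree) (shift (C ⊖ D) ⊕ C) n         ≡⟨ rev-⊕ (suc degree) (shift (C ⊖ D)) C n ⟩
    rev (suc degree) (shift (C ⊖ D)) n + rev (suc degree) C n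
      ≡⟨ cong₂ _+_ (rev-shift degree (C ⊖ D) n) (rev-suc degree C deg-C n) ⟩
    rev degree (C ⊖ D) n + shift (rev degree C) n
      ≡⟨ cong₂ _+_ (rev-⊖ degree C D n) (shift-cong rev-C n) ⟩
    (rev degree C n - rev degree D n) + shift A n   ≡⟨ cong (λ x → (x - _) + _) (rev-C n) ⟩
    (A n - rev degree D n) + shift A n              ≡⟨ cong (λ x → (A n - x) + _) (rev-D n) ⟩
    (A n - (A n - B n)) + shift A n                 ≡⟨ cancel (A n) (B n) (shift A n) ⟩
    shift A n + B n                                 ∎
    where
    cancel : ∀ a b s → (a - (a - b)) + s ≡ s + b
    cancel = solve-∀
  rev-B′ : rev (suc degree) B ≐ (shift (C ⊖ D) ⊕ C) ⊖ C
  rev-B′ n = begin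
    rev (suc degree) B n       ≡⟨ rev-suc degree B deg-B n ⟩
    shift (rev degree B) n     ≡⟨ shift-cong rev-B n ⟩
    shift (C ⊖ D) n            ≡⟨ x≡x+y-y _ (C n) ⟩
    shift (C ⊖ D) n + C n - C n ∎
  rev-D′ : rev (suc degree) C ≐ (shift A ⊕ B) ⊖ B
  rev-D′ n = begin
    rev (suc degree) C n       ≡⟨ rev-suc degree C deg-C n ⟩
    shift (rev degree C) n     ≡⟨ shift-cong rev-C n ⟩
    shift A n                  ≡⟨ x≡x+y-y _ (B n) ⟩
    shift A n + B n - B n      ∎

-- Negative continued fractions

negCF-fuel-irrelevant : ∀ m n r s → s ≤ m → s ≤ n → negCF-fuel m r s ≡ negCF-fuel n r s
negCF-fuel-irrelevant zero    zero    r zero    _ _ = refl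
negCF-fuel-irrelevant zero    (suc n) r zero    _ _ = refl
negCF-fuel-irrelevant (suc m) zero    r zero    _ _ = refl
negCF-fuel-irrelevant (suc m) (suc n) r zero    _ _ = refl
negCF-fuel-irrelevant (suc m) (suc n) r (suc s) (s≤s s≤m) (s≤s s≤n) with r % suc s
... | zero  = refl
... | suc t = cong (suc (r / suc s) ∷_)
  (negCF-fuel-irrelevant m n (suc s) (s ∸ t)
    (ℕP.≤-trans (ℕP.m∸n≤m s t) s≤m) (ℕP.≤-trans (ℕP.m∸n≤m s t) s≤n))

negCF-exact : ∀ r s → r % suc s ≡ 0 → negCF r (suc s) ≡ r / suc s ∷ []
negCF-exact r s r%S≡0 with r % suc s | r%S≡0
... | zero | refl = refl

negCF-inexact : ∀ r s t → r % suc s ≡ suc t →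
                negCF r (suc s) ≡ suc (r / suc s) ∷ negCF (suc s) (s ∸ t)
negCF-inexact r s t r%S≡1+t with r % suc s | r%S≡1+t
... | suc t | refl = cong (suc (r / suc s) ∷_)
  (negCF-fuel-irrelevant s (s ∸ t) (suc s) (s ∸ t) (ℕP.m∸n≤m s t) ℕP.≤-refl)

[n+m]%n≡m%n : ∀ m n → (suc n ℕ.+ m) % suc n ≡ m % suc n
[n+m]%n≡m%n m n = %-remove-+ˡ m ∣-refl

[n+m]/n≡1+m/n : ∀ m n → (suc n ℕ.+ m) / suc n ≡ suc (m / suc n)
[n+m]/n≡1+m/n m n = trans (+-distrib-/-∣ˡ m ∣-refl) (cong (ℕ._+ m / suc n) (n/n≡1 (suc n)))

-- (S + t) / S = t / S + 1 with the same remainder.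
negCF-+-denominator : ∀ s t → suc s ≤ t → ∃₂ λ c cs →
  negCF t (suc s) ≡ suc c ∷ cs × negCF (suc s ℕ.+ t) (suc s) ≡ suc (suc c) ∷ cs
negCF-+-denominator s t S≤t = by-remainder (t % suc s) refl
  where
  S+t%S≡ : ∀ {m} → t % suc s ≡ m → (suc s ℕ.+ t) % suc s ≡ m
  S+t%S≡ = trans ([n+m]%n≡m%n t s)
  t/S≡1+c : t / suc s ≡ suc (pred (t / suc s))
  t/S≡1+c = sym (ℕP.suc-pred (t / suc s) {{ℕ.>-nonZero (m≥n⇒m/n>0 S≤t)}})
  by-remainder : ∀ m → t % suc s ≡ m → ∃₂ λ c cs →
    negCF t (suc s) ≡ suc c ∷ cs × negCF (suc s ℕ.+ t) (suc s) ≡ suc (suc c) ∷ cs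
  by-remainder zero t%S = pred (t / suc s) , []
    , trans (negCF-exact t s t%S) (cong (_∷ []) t/S≡1+c)
    , trans (negCF-exact (suc s ℕ.+ t) s (S+t%S≡ t%S))
            (cong (_∷ []) (trans ([n+m]/n≡1+m/n t s) (cong suc t/S≡1+c)))
  by-remainder (suc u) t%S = t / suc s , negCF (suc s) (s ∸ u)
    , negCF-inexact t s u t%S
    , trans (negCF-inexact (suc s ℕ.+ t) s u (S+t%S≡ t%S))
            (cong (λ c → suc c ∷ negCF (suc s) (s ∸ u)) ([n+m]/n≡1+m/n t s))

-- (2S + U) / (S + U) = 2 - 1 / ((S + U) / U)
negCF-2∷ : ∀ s u → negCF (suc s ℕ.+ (suc s ℕ.+ suc u)) (suc s ℕ.+ suc u)
                   ≡ 2 ∷ negCF (suc s ℕ.+ suc u) (suc u)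
negCF-2∷ s u = trans (negCF-inexact (S ℕ.+ T) (s ℕ.+ suc u) s S+T%T)
                     (cong₂ _∷_ (cong suc S+T/T) (cong (negCF T) (ℕP.m+n∸m≡n s (suc u))))
  where
  S = suc s
  T = suc s ℕ.+ suc u
  S<T : S < T
  S<T = ℕP.m<m+n S (s≤s ℕ.z≤n)
  S+T%T : (S ℕ.+ T) % T ≡ S
  S+T%T = trans (%-remove-+ʳ S {T} ∣-refl) (m<n⇒m%n≡m S<T)
  S+T/T : (S ℕ.+ T) / T ≡ 1
  S+T/T = trans (+-distrib-/-∣ʳ S {T} ∣-refl) (cong₂ ℕ._+_ (m<n⇒m/n≡0 S<T) (n/n≡1 T))

MirrorCF : ℕ → ℕ → ℕ → Set
MirrorCF p S T = Mirror R[ negCF p S ] S[ negCF p S ] R[ negCF p T ] S[ negCF p T ]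

mirrorCF-diagonal : ∀ s → MirrorCF (suc s ℕ.+ suc s) (suc s) (suc s)
mirrorCF-diagonal s = mirror-resp R≐11 S≐1 R≐11 S≐1 mirror-base
  where
  S+S≡[2] : negCF (suc s ℕ.+ suc s) (suc s) ≡ 2 ∷ []
  S+S≡[2] = trans (negCF-exact (suc s ℕ.+ suc s) s (trans ([n+m]%n≡m%n (suc s) s) (n%n≡0 (suc s))))
                  (cong (_∷ []) (trans ([n+m]/n≡1+m/n (suc s) s) (cong suc (n/n≡1 (suc s)))))
  R≐11 : R[ negCF (suc s ℕ.+ suc s) (suc s) ] ≐ coeff (+ 1 ∷ + 1 ∷ [])
  R≐11 n rewrite S+S≡[2] = R[2]≐11 n
    where
    R[2]≐11 : R[ 2 ∷ [] ] ≐ coeff (+ 1 ∷ + 1 ∷ [])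
    R[2]≐11 zero          = refl
    R[2]≐11 (suc zero)    = refl
    R[2]≐11 (suc (suc n)) = refl
  S≐1 : S[ negCF (suc s ℕ.+ suc s) (suc s) ] ≐ coeff (+ 1 ∷ [])
  S≐1 n rewrite S+S≡[2] = refl

mirrorCF-step : ∀ s u → MirrorCF (suc s ℕ.+ suc u) (suc s) (suc u) →
                MirrorCF (suc s ℕ.+ (suc s ℕ.+ suc u)) (suc s) (suc s ℕ.+ suc u)
mirrorCF-step s u m with negCF-+-denominator s (suc s ℕ.+ suc u) (ℕP.m≤m+n (suc s) (suc u))
... | c , cs , T/S≡ , p/S≡ = mirror-resp eA eB eC eD (mirror-step m)
  where
  open ≡-Reasoning
  S = suc s
  T = suc s ℕ.+ suc u
  p = S ℕ.+ T
  eA : R[ negCF p S ] ≐ shift R[ negCF T S ] ⊕ S[ negCF T S ]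
  eA n = begin
    R[ negCF p S ] n                          ≡⟨ cong (λ l → R[ l ] n) p/S≡ ⟩
    R[ suc (suc c) ∷ cs ] n                   ≡⟨ R-2+∷ c cs n ⟩
    shift R[ suc c ∷ cs ] n + R[ cs ] n       ≡⟨ cong (λ l → shift R[ l ] n + S[ l ] n) (sym T/S≡) ⟩
    shift R[ negCF T S ] n + S[ negCF T S ] n ∎
  eB : S[ negCF p S ] ≐ S[ negCF T S ]
  eB n = trans (cong (λ l → S[ l ] n) p/S≡) (cong (λ l → S[ l ] n) (sym T/S≡))
  eC : R[ negCF p T ] ≐ shift (R[ negCF T (suc u) ] ⊖ S[ negCF T (suc u) ]) ⊕ R[ negCF T (suc u) ]
  eC n = begin
    R[ negCF p T ] n                          ≡⟨ cong (λ l → R[ l ] n) (negCF-2∷ s u) ⟩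
    R[ 2 ∷ negCF T (suc u) ] n                ≡⟨ R-2+∷ 0 (negCF T (suc u)) n ⟩
    shift R[ 1 ∷ negCF T (suc u) ] n + R[ negCF T (suc u) ] n
      ≡⟨ cong (_+ R[ negCF T (suc u) ] n) (shift-cong (R-1∷ (negCF T (suc u))) n) ⟩
    shift (R[ negCF T (suc u) ] ⊖ S[ negCF T (suc u) ]) n + R[ negCF T (suc u) ] n ∎
  eD : S[ negCF p T ] ≐ R[ negCF T (suc u) ]
  eD n = cong (λ l → S[ l ] n) (negCF-2∷ s u)

mirrorCF-swap : ∀ s t → MirrorCF (suc t ℕ.+ suc s) (suc t) (suc s) →
                MirrorCF (suc s ℕ.+ suc t) (suc s) (suc t)
mirrorCF-swap s t m =
  mirror-swap (subst (λ p → MirrorCF p (suc t) (suc s)) (ℕP.+-comm (suc t) (suc s)) m)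

Mirrors< : ℕ → Set
Mirrors< n = ∀ s t → s ℕ.+ t < n → MirrorCF (suc s ℕ.+ suc t) (suc s) (suc t)

-- Euclid's algorithm on (S, T): (S, S + U) comes from (S, U).
mirrorCF-< : ∀ {n s t} → Mirrors< n → s < t → s ℕ.+ t < suc n →
             MirrorCF (suc s ℕ.+ suc t) (suc s) (suc t)
mirrorCF-< {n} {s} {t} ih s<t s+t<1+n =
  subst (λ T → MirrorCF (suc s ℕ.+ T) (suc s) T) S+U≡T (mirrorCF-step s u (ih s u s+u<n))
  where
  u = t ∸ suc s
  S+u≡t : suc s ℕ.+ u ≡ t
  S+u≡t = ℕP.m+[n∸m]≡n s<t
  S+U≡T : suc s ℕ.+ suc u ≡ suc t
  S+U≡T = trans (ℕP.+-suc (suc s) u) (cong suc S+u≡t)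
  s+u<n : s ℕ.+ u < n
  s+u<n = ℕP.<-≤-trans (subst (s ℕ.+ u <_) S+u≡t ℕP.≤-refl)
                       (ℕP.≤-trans (ℕP.m≤n+m t s) (ℕP.≤-pred s+t<1+n))

mirrors< : ∀ n → Mirrors< n
mirrors< zero    s t ()
mirrors< (suc n) s t s+t<1+n with ℕP.<-cmp s t
... | tri< s<t _ _  = mirrorCF-< (mirrors< n) s<t s+t<1+n
... | tri≈ _ refl _ = mirrorCF-diagonal s
... | tri> _ _ t<s  = mirrorCF-swap s t
  (mirrorCF-< (mirrors< n) t<s (subst (_< suc n) (ℕP.+-comm s t) s+t<1+n))

mirrorCF : ∀ s t → MirrorCF (suc s ℕ.+ suc t) (suc s) (suc t)
mirrorCF s t = mirrors< (suc (s ℕ.+ t)) s t ℕP.≤-refl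

-- Normal forms and reciprocal polynomials

infixr 5 _∷?_
_∷?_ : ℤ → Poly → Poly
a ∷? []      with a ℤP.≟ + 0
... | yes _ = []
... | no  _ = a ∷ []
a ∷? (b ∷ f) = a ∷ b ∷ f

-- norm computed by structural recursion from the constant term upwards.
trim : Poly → Poly
trim []      = []
trim (a ∷ f) = a ∷? trim f

coeff-∷? : ∀ a f → coeff (a ∷? f) ≐ coeff (a ∷ f)
coeff-∷? a []      n with a ℤP.≟ + 0
coeff-∷? a []      zero    | yes a≡0 = sym a≡0
coeff-∷? a []      (suc n) | yes _   = refl
coeff-∷? a []      n       | no  _   = refl
coeff-∷? a (b ∷ f) n = refl

coeff-trim : ∀ f → coeff (trim f) ≐ coeff f
coeff-trim []      n       = refl
coeff-trim (a ∷ f) zero    = coeff-∷? a (trim f) zero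
coeff-trim (a ∷ f) (suc n) = trans (coeff-∷? a (trim f) (suc n)) (coeff-trim f n)

trim-zero : ∀ f → coeff f ≐ (λ _ → + 0) → trim f ≡ []
trim-zero []      f≐0 = refl
trim-zero (a ∷ f) f≐0 rewrite trim-zero f (λ n → f≐0 (suc n)) | f≐0 0 = refl

trim-cong : ∀ f g → coeff f ≐ coeff g → trim f ≡ trim g
trim-cong []      g       f≐g = sym (trim-zero g (λ n → sym (f≐g n)))
trim-cong (a ∷ f) []      f≐g = trim-zero (a ∷ f) f≐g
trim-cong (a ∷ f) (b ∷ g) f≐g = cong₂ _∷?_ (f≐g 0) (trim-cong f g (λ n → f≐g (suc n)))

∷?-∷ʳ : ∀ a f b → a ∷? (f ∷ʳ b) ≡ a ∷ (f ∷ʳ b)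
∷?-∷ʳ a []      b = refl
∷?-∷ʳ a (c ∷ f) b = refl

dropZeros : Poly → Poly
dropZeros = dropWhile (λ x → x ℤP.≟ + 0)

reverse-dropZeros-∷ʳ : ∀ f a → reverse (dropZeros (f ∷ʳ a)) ≡ a ∷? reverse (dropZeros f)
reverse-dropZeros-∷ʳ []      a with a ℤP.≟ + 0
... | yes _ = refl
... | no  _ = refl
reverse-dropZeros-∷ʳ (b ∷ f) a with b ℤP.≟ + 0
... | yes _ = reverse-dropZeros-∷ʳ f a
... | no  _ = begin
  reverse ((b ∷ f) ∷ʳ a)     ≡⟨ List.reverse-++ (b ∷ f) (a ∷ []) ⟩
  a ∷ reverse (b ∷ f)        ≡⟨ cong (a ∷_) (List.unfold-reverse b f) ⟩
  a ∷ (reverse f ∷ʳ b)       ≡⟨ ∷?-∷ʳ a (reverse f) b ⟨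
  a ∷? (reverse f ∷ʳ b)      ≡⟨ cong (a ∷?_) (List.unfold-reverse b f) ⟨
  a ∷? reverse (b ∷ f)       ∎
  where open ≡-Reasoning

norm≡trim : ∀ f → norm f ≡ trim f
norm≡trim []      = refl
norm≡trim (a ∷ f) = begin
  reverse (dropZeros (reverse (a ∷ f)))  ≡⟨ cong (λ l → reverse (dropZeros l)) (List.unfold-reverse a f) ⟩
  reverse (dropZeros (reverse f ∷ʳ a))   ≡⟨ reverse-dropZeros-∷ʳ (reverse f) a ⟩
  a ∷? norm f                            ≡⟨ cong (a ∷?_) (norm≡trim f) ⟩
  a ∷? trim f                            ∎
  where open ≡-Reasoning

coeff-≈ₚ : ∀ f g → coeff f ≐ coeff g → f ≈ₚ g
coeff-≈ₚ f g f≐g = trans (norm≡trim f) (trans (trim-cong f g f≐g) (sym (norm≡trim g)))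

coeff-++ : ∀ f g → coeff (f ++ g) ≐ coeff f ⊕ shiftBy (length f) (coeff g)
coeff-++ []      g n       = sym (ℤP.+-identityˡ (coeff g n))
coeff-++ (a ∷ f) g zero    = sym (ℤP.+-identityʳ a)
coeff-++ (a ∷ f) g (suc n) = coeff-++ f g n

rev-∷ : ∀ d a f → rev (suc d) (coeff (a ∷ f)) ≐ rev d (coeff f) ⊕ shiftBy (suc d) (coeff (a ∷ []))
rev-∷ zero    a f zero          = sym (ℤP.+-identityʳ (coeff f 0))
rev-∷ zero    a f (suc zero)    = sym (ℤP.+-identityˡ a)
rev-∷ zero    a f (suc (suc n)) = refl
rev-∷ (suc d) a f zero          = sym (ℤP.+-identityʳ (coeff f (suc d)))
rev-∷ (suc d) a f (suc n)       = rev-∷ d a f n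

coeff-reverse-∷ : ∀ a f → coeff (reverse (a ∷ f)) ≐ rev (length f) (coeff (a ∷ f))
coeff-reverse-∷ a []      zero    = refl
coeff-reverse-∷ a []      (suc n) = refl
coeff-reverse-∷ a (b ∷ f) n = begin
  coeff (reverse (a ∷ b ∷ f)) n
    ≡⟨ cong (λ l → coeff l n) (List.unfold-reverse a (b ∷ f)) ⟩
  coeff (reverse (b ∷ f) ∷ʳ a) n
    ≡⟨ coeff-++ (reverse (b ∷ f)) (a ∷ []) n ⟩
  coeff (reverse (b ∷ f)) n + shiftBy (length (reverse (b ∷ f))) (coeff (a ∷ [])) n
    ≡⟨ cong₂ _+_ (coeff-reverse-∷ b f n)
                 (cong (λ k → shiftBy k (coeff (a ∷ [])) n) (List.length-reverse (b ∷ f))) ⟩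
  rev (length f) (coeff (b ∷ f)) n + shiftBy (length (b ∷ f)) (coeff (a ∷ [])) n
    ≡⟨ rev-∷ (length f) a (b ∷ f) n ⟨
  rev (length (b ∷ f)) (coeff (a ∷ b ∷ f)) n ∎
  where open ≡-Reasoning

coeff-reverse : ∀ f {d} → length f ≡ suc d → coeff (reverse f) ≐ rev d (coeff f)
coeff-reverse (a ∷ f) refl = coeff-reverse-∷ a f

coeff-≥-length : ∀ f {n} → length f ≤ n → coeff f n ≡ + 0
coeff-≥-length []      _         = refl
coeff-≥-length (a ∷ f) (s≤s f≤n) = coeff-≥-length f f≤n

length-∷? : ∀ a f → length (a ∷? f) ≤ suc (length f)
length-∷? a []      with a ℤP.≟ + 0
... | yes _ = z≤n
... | no  _ = ℕP.≤-refl
length-∷? a (b ∷ f) = ℕP.≤-refl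

length-trim : ∀ d f → Degree≤ d (coeff f) → length (trim f) ≤ suc d
length-trim d       []      deg = z≤n
length-trim zero    (a ∷ f) deg
  rewrite trim-zero f (λ n → deg (suc n) (s≤s z≤n)) = length-∷? a []
length-trim (suc d) (a ∷ f) deg =
  ℕP.≤-trans (length-∷? a (trim f)) (s≤s (length-trim d f (λ n d<n → deg (suc n) (s≤s d<n))))

length-trim-exact : ∀ d f → Degree≤ d (coeff f) → coeff f d ≢ + 0 → length (trim f) ≡ suc d
length-trim-exact d f deg f[d]≢0 = ℕP.≤-antisym (length-trim d f deg) (ℕP.≮⇒≥ short⇒f[d]≡0)
  where
  short⇒f[d]≡0 : ¬ length (trim f) < suc d
  short⇒f[d]≡0 (s≤s len≤d) = f[d]≢0 (trans (sym (coeff-trim f d)) (coeff-≥-length (trim f) len≤d))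

coeff-reciprocal : ∀ d f → Degree≤ d (coeff f) → coeff f d ≢ + 0 → coeff (reciprocal f) ≐ rev d (coeff f)
coeff-reciprocal d f deg f[d]≢0 n rewrite norm≡trim f =
  trans (coeff-reverse (trim f) (length-trim-exact d f deg f[d]≢0) n) (rev-cong d (coeff-trim f) n)

R-reciprocal : ∀ {p} S T → S ℕ.+ T ≡ p → S ≢ 0 → T ≢ 0 → Rₚ (negCF p T) ≈ₚ reciprocal (Rₚ (negCF p S))
R-reciprocal zero    T       _    S≢0 _   = contradiction refl S≢0
R-reciprocal (suc s) zero    _    _   T≢0 = contradiction refl T≢0
R-reciprocal (suc s) (suc t) refl _   _   =
  coeff-≈ₚ (Rₚ (negCF p (suc t))) (reciprocal (Rₚ (negCF p (suc s))))
    (λ n → sym (trans (coeff-reciprocal degree (Rₚ (negCF p (suc s))) deg-A top≢0 n) (rev-A n)))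
  where
  p = suc s ℕ.+ suc t
  open Mirror (mirrorCF s t)
  top≢0 : R[ negCF p (suc s) ] degree ≢ + 0
  top≢0 top≡0 with trans (sym top≡0) (trans (sym (rev-0 degree _)) (trans (rev-A 0) C-0))
  ... | ()

-- Numerators modulo p

-- For a ≤ p, 𝒮 expands the numerator a + p (⌊|p - a| / p⌋ + 1) instead of a.
raise : ℕ → ℤ → ℤ
raise s a = a + + suc s * + suc (∣ + suc s - a ∣ / suc s)

raise-congruent : ∀ s a → ¬ (+ suc s ℤ.< a) → (+ suc s) ∣ₛ (+ ∣ raise s a ∣ - a)
raise-congruent s a p≮a = Signed.divides (+ suc q) r-a≡
  where
  P = suc s
  m = ∣ + P - a ∣
  q = m / P
  m≤[1+q]P : m ≤ suc q ℕ.* P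
  m≤[1+q]P = ℕP.≤-trans (ℕP.≤-reflexive (m≡m%n+[m/n]*n m P)) (ℕP.+-monoˡ-≤ (q ℕ.* P) (m%n≤n m P))
  +m≡P-a : + m ≡ + P - a
  +m≡P-a = ℤP.0≤i⇒+∣i∣≡i (ℤP.i≤j⇒0≤j-i (ℤP.≮⇒≥ p≮a))
  a+[P-a]≡P : ∀ a P → a + (P - a) ≡ P
  a+[P-a]≡P = solve-∀
  a+Pk-a≡kP : ∀ a P k → a + P * k - a ≡ k * P
  a+Pk-a≡kP = solve-∀
  P≤x : + P ℤ.≤ raise s a
  P≤x = begin
    + P                   ≡⟨ a+[P-a]≡P a (+ P) ⟨
    a + (+ P - a)         ≡⟨ cong (λ k → a + k) +m≡P-a ⟨
    a + + m               ≤⟨ ℤP.+-monoʳ-≤ a (ℤ.+≤+ m≤[1+q]P) ⟩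
    a + + (suc q ℕ.* P)   ≡⟨ cong (λ k → a + + k) (ℕP.*-comm (suc q) P) ⟩
    a + + (P ℕ.* suc q)   ≡⟨ cong (λ k → a + k) (ℤP.pos-* P (suc q)) ⟩
    raise s a             ∎
    where open ℤP.≤-Reasoning
  r-a≡ : + ∣ raise s a ∣ - a ≡ + suc q * + P
  r-a≡ = trans (cong (_- a) (ℤP.0≤i⇒+∣i∣≡i (ℤP.≤-trans (ℤ.+≤+ ℕ.z≤n) P≤x))) (a+Pk-a≡kP a (+ P) (+ suc q))

𝒮-numerator : ∀ s a → ∃ λ r → (+ suc s) ∣ₛ (+ r - a) × 𝒮 a (suc s) ≡ Sₚ (negCF r (suc s))
𝒮-numerator s (+ n) with + suc s ℤ.<? + n
... | yes _   = n , Signed.divides (+ 0) (ℤP.+-inverseʳ (+ n)) , refl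
... | no  p≮n = ∣ raise s (+ n) ∣ , raise-congruent s (+ n) p≮n , refl
𝒮-numerator s -[1+ n ] with + suc s ℤ.<? -[1+ n ]
... | yes ()
... | no  p≮a = ∣ raise s -[1+ n ] ∣ , raise-congruent s -[1+ n ] p≮a , refl

S-negCF-residue : ∀ r s → r % suc s ≢ 0 → Sₚ (negCF r (suc s)) ≡ Rₚ (negCF (suc s) (suc s ∸ r % suc s))
S-negCF-residue r s = by-remainder (r % suc s) refl
  where
  by-remainder : ∀ t → r % suc s ≡ t → t ≢ 0 → Sₚ (negCF r (suc s)) ≡ Rₚ (negCF (suc s) (suc s ∸ t))
  by-remainder zero    _    0≢0 = contradiction refl 0≢0
  by-remainder (suc t) r%p≡ _   = cong Sₚ (negCF-inexact r s t r%p≡)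

residue≢0 : ∀ {p} r a .{{_ : NonZero p}} → 2 ≤ p → Coprime ∣ a ∣ p → (+ p) ∣ₛ (+ r - a) → r % p ≢ 0
residue≢0 {p} r a 2≤p a⊥p p∣r-a r%p≡0 = ℕP.<⇒≢ 2≤p (sym (a⊥p (p∣a , ∣-refl)))
  where
  p∣a : p ℕ∣.∣ ∣ a ∣
  p∣a = subst (p ℕ∣.∣_) (ℤP.∣-i∣≡∣i∣ a)
          (∣⇒∣ᵤ {i = - a} (Signed.∣m+n∣m⇒∣n {m = + r} p∣r-a (∣ᵤ⇒∣ (m%n≡0⇒n∣m r p r%p≡0))))

residues-complementary : ∀ {p} x y .{{_ : NonZero p}} → p ℕ∣.∣ x ℕ.+ y → x % p ≢ 0 → x % p ℕ.+ y % p ≡ p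
residues-complementary {p} x y p∣x+y x%p≢0
  with m%n≡0⇒n∣m _ p (trans (sym (%-distribˡ-+ x y p)) (n∣m⇒m%n≡0 _ p p∣x+y))
... | divides zero          eq = contradiction (ℕP.m+n≡0⇒m≡0 (x % p) eq) x%p≢0
... | divides (suc zero)    eq = trans eq (ℕP.+-identityʳ p)
... | divides (suc (suc k)) eq = contradiction (subst (p ℕ.+ p ≤_) (sym eq) 2p≤[2+k]p)
                                               (ℕP.<⇒≱ (ℕP.+-mono-< (m%n<n x p) (m%n<n y p)))
  where
  2p≤[2+k]p : p ℕ.+ p ≤ suc (suc k) ℕ.* p
  2p≤[2+k]p = ℕP.+-monoʳ-≤ p (ℕP.m≤m+n p (k ℕ.* p))

numerators-sum : ∀ {p} a b ra rb → (+ p) ∣ₛ (+ ra - a) → (+ p) ∣ₛ (+ rb - b) → (+ p) ∣ (a + b) →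
                 p ℕ∣.∣ ra ℕ.+ rb
numerators-sum {p} a b ra rb p∣ra-a p∣rb-b p∣a+b =
  ∣⇒∣ᵤ (subst ((+ p) ∣ₛ_) sum≡ (Signed.∣m∣n⇒∣m+n (Signed.∣m∣n⇒∣m+n p∣ra-a p∣rb-b) (∣ᵤ⇒∣ p∣a+b)))
  where
  telescope : ∀ x y a b → (x - a) + (y - b) + (a + b) ≡ x + y
  telescope = solve-∀
  sum≡ : (+ ra - a) + (+ rb - b) + (a + b) ≡ + (ra ℕ.+ rb)
  sum≡ = trans (telescope (+ ra) (+ rb) a b) (sym (ℤP.pos-+ ra rb))

proposition3p2 : (p : ℕ) → 2 ≤ p → (a b : ℤ) →
    Coprime ∣ a ∣ p → Coprime ∣ b ∣ p →
    (+ p) ∣ (a + b) →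
    𝒮 a p ≈ₚ reciprocal (𝒮 b p)
proposition3p2 p@(suc s) 2≤p a b a⊥p b⊥p p∣a+b
  with 𝒮-numerator s a | 𝒮-numerator s b
... | ra , p∣ra-a , 𝒮a≡ | rb , p∣rb-b , 𝒮b≡ = begin
  norm (𝒮 a p)                               ≡⟨ cong norm (trans 𝒮a≡ (S-negCF-residue ra s ta≢0)) ⟩
  norm (Rₚ (negCF p (p ∸ ta)))               ≡⟨ cong (λ k → norm (Rₚ (negCF p k))) p∸ta≡tb ⟩
  norm (Rₚ (negCF p tb))                     ≡⟨ R-reciprocal ta tb ta+tb≡p ta≢0 tb≢0 ⟩
  norm (reciprocal (Rₚ (negCF p ta)))
    ≡⟨ cong (λ k → norm (reciprocal (Rₚ (negCF p k)))) p∸tb≡ta ⟨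
  norm (reciprocal (Rₚ (negCF p (p ∸ tb))))
    ≡⟨ cong (norm ∘ reciprocal) (trans 𝒮b≡ (S-negCF-residue rb s tb≢0)) ⟨
  norm (reciprocal (𝒮 b p))                  ∎
  where
  open ≡-Reasoning
  ta tb : ℕ
  ta = ra % p
  tb = rb % p
  ta≢0 : ta ≢ 0
  ta≢0 = residue≢0 ra a 2≤p a⊥p p∣ra-a
  tb≢0 : tb ≢ 0
  tb≢0 = residue≢0 rb b 2≤p b⊥p p∣rb-b
  ta+tb≡p : ta ℕ.+ tb ≡ p
  ta+tb≡p = residues-complementary ra rb (numerators-sum a b ra rb p∣ra-a p∣rb-b p∣a+b) ta≢0
  p∸ta≡tb : p ∸ ta ≡ tb
  p∸ta≡tb = trans (cong (_∸ ta) (sym ta+tb≡p)) (ℕP.m+n∸m≡n ta tb)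
  p∸tb≡ta : p ∸ tb ≡ ta
  p∸tb≡ta = trans (cong (_∸ tb) (sym ta+tb≡p)) (ℕP.m+n∸n≡m ta tb)
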